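{- Let $\alpha=(2,3,3,3,\ldots)$ and $\beta=(1,1,1,\ldots)$. Then for every $n\geq1$, $\mathrm{Mot}_n(\alpha,\beta)=\#\mathrm{SCH}_{\mathrm{even}}(n)$.
   Context: A Motzkin path of length $n$ is a lattice path from $(0,0)$ to $(n,0)$ with steps $U=(1,1)$, $D=(1,-1)$, $H=(1,0)$ never going below the $x$-axis. The height of a step is the $y$-coordinate of its ending point. The weight of a Motzkin path with respect to $(\alpha,\beta)$ is the product of $\alpha_i$ over horizontal steps of height $i$ and $\beta_i$ over down steps of height $i$; $\mathrm{Mot}_n(\alpha,\beta)$ is the sum of the weights of Motzkin paths of length $n$. A Schröder path of length $2n$ is a lattice path from $(0,0)$ to $(2n,0)$ with steps $U=(1,1)$, $D=(1,-1)$ and double horizontal steps $HH=(2,0)$ never going below the $x$-axis. $\mathrm{SCH}_{\mathrm{even}}(n)$ is the set of Schröder paths of length $2n$ all of whose horizontal steps have even height. -}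

module Defs where

open import Data.Nat using (ℕ; zero; suc; _+_; _*_)
open import Data.Nat.Properties using (_≟_)
open import Data.Nat.Base using (_%_)
open import Data.Bool using (Bool; true; false; _∧_)
open import Data.List using (List; []; _∷_; map; concatMap; filterᵇ; length; _++_)
open import Data.Nat.ListAction using (sum)

-- Motzkin steps: U = (1,1), D = (1,-1), H = (1,0)
data MStep : Set where
  U D H : MStep

words : ℕ → List (List MStep)
words zero = [] ∷ []
words (suc n) = concatMap (λ w → (U ∷ w) ∷ (D ∷ w) ∷ (H ∷ w) ∷ []) (words n)

motzkinFrom : ℕ → List MStep → Bool
motzkinFrom zero    [] = true
motzkinFrom (suc _) [] = false
motzkinFrom h       (U ∷ s) = motzkinFrom (suc h) s
motzkinFrom zero    (D ∷ s) = false
motzkinFrom (suc h) (D ∷ s) = motzkinFrom h s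
motzkinFrom h       (H ∷ s) = motzkinFrom h s

isMotzkin : List MStep → Bool
isMotzkin = motzkinFrom 0

-- weight w.r.t. (α, β): the height of a step is the y-coordinate of its
-- ending point; H at height i contributes α i, D ending at height i
-- contributes β i.
weightFrom : (ℕ → ℕ) → (ℕ → ℕ) → ℕ → List MStep → ℕ
weightFrom α β h       [] = 1
weightFrom α β h       (U ∷ s) = weightFrom α β (suc h) s
weightFrom α β zero    (D ∷ s) = 0  -- never occurs for valid paths
weightFrom α β (suc h) (D ∷ s) = β h * weightFrom α β h s
weightFrom α β h       (H ∷ s) = α h * weightFrom α β h s

Mot : ℕ → (ℕ → ℕ) → (ℕ → ℕ) → ℕ
Mot n α β = sum (map (weightFrom α β 0) (filterᵇ isMotzkin (words n)))

αseq : ℕ → ℕ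
αseq zero    = 2
αseq (suc _) = 3

βseq : ℕ → ℕ
βseq _ = 1

-- Schröder steps: U = (1,1), D = (1,-1), HH = (2,0)
data SStep : Set where
  SU SD SHH : SStep

slen : SStep → ℕ
slen SHH = 2
slen _   = 1

swords : ℕ → List (List SStep)
swords zero = [] ∷ []
swords (suc zero) = concatMap (λ w → (SU ∷ w) ∷ (SD ∷ w) ∷ []) (swords zero)
swords (suc (suc m)) =
  concatMap (λ w → (SU ∷ w) ∷ (SD ∷ w) ∷ []) (swords (suc m))
  ++ map (SHH ∷_) (swords m)

even : ℕ → Bool
even zero = true
even (suc zero) = false
even (suc (suc h)) = even h

schEvenFrom : ℕ → List SStep → Bool
schEvenFrom zero    [] = true
schEvenFrom (suc _) [] = false
schEvenFrom h       (SU ∷ s) = schEvenFrom (suc h) s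
schEvenFrom zero    (SD ∷ s) = false
schEvenFrom (suc h) (SD ∷ s) = schEvenFrom h s
schEvenFrom h       (SHH ∷ s) = even h ∧ schEvenFrom h s

numSCHeven : ℕ → ℕ
numSCHeven n = length (filterᵇ (schEvenFrom 0) (swords (n + n)))

module Submission where

-- Count paths by length and starting height.  Since a path in SCH_even has no
-- horizontal step at odd height, it is back at an even height after every two
-- unit steps: from 2k > 0 it moves to 2k + 2 (UU), to 2k - 2 (DD) or stays at
-- 2k in three ways (UD, DU, HH); from height 0 only UU, UD and HH are possible.  These are the weights α = (2,3,3,…),
-- β = (1,1,…) of a Motzkin step, so the number of such Schröder suffixes of
-- length 2n from height 2k satisfies the first-step recurrence of the
-- weighted Motzkin paths of length n from height k.

open import Defs
open import Data.Bool using (Bool; true; false; if_then_else_)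
open import Data.List using (List; []; _∷_; map; concatMap; filterᵇ; length; _++_)
open import Data.List.Properties using (map-++; map-cong; map-∘)
open import Data.Nat using (ℕ; _≥_; zero; suc; _+_; _*_)
open import Data.Nat.ListAction using (sum)
open import Data.Nat.ListAction.Properties using (sum-++)
open import Data.Nat.Properties using (+-suc; +-identityʳ; *-zeroʳ; *-distribˡ-+)
open import Data.Nat.Tactic.RingSolver using (solve-∀)
open import Function using (_∘_)
open import Relation.Binary.PropositionalEquality

private
  variable
    A B : Set

sum-map-++ : (f : A → ℕ) (xs ys : List A) →
             sum (map f (xs ++ ys)) ≡ sum (map f xs) + sum (map f ys)
sum-map-++ f xs ys = trans (cong sum (map-++ f xs ys)) (sum-++ (map f xs) (map f ys))

sum-map-concatMap : (f : B → ℕ) (g : A → List B) (xs : List A) →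
                    sum (map f (concatMap g xs)) ≡ sum (map (sum ∘ map f ∘ g) xs)
sum-map-concatMap f g []       = refl
sum-map-concatMap f g (x ∷ xs) =
  trans (sum-map-++ f (g x) (concatMap g xs))
        (cong (sum (map f (g x)) +_) (sum-map-concatMap f g xs))

sum-map-+ : (f g : A → ℕ) (xs : List A) →
            sum (map (λ x → f x + g x) xs) ≡ sum (map f xs) + sum (map g xs)
sum-map-+ f g []       = refl
sum-map-+ f g (x ∷ xs) =
  trans (cong (f x + g x +_) (sum-map-+ f g xs))
        (interchange (f x) (g x) (sum (map f xs)) (sum (map g xs)))
  where
  interchange : ∀ a b c d → a + b + (c + d) ≡ (a + c) + (b + d)
  interchange = solve-∀

sum-map-* : (c : ℕ) (f : A → ℕ) (xs : List A) →
            sum (map (λ x → c * f x) xs) ≡ c * sum (map f xs)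
sum-map-* c f []       = sym (*-zeroʳ c)
sum-map-* c f (x ∷ xs) =
  trans (cong (c * f x +_) (sum-map-* c f xs)) (sym (*-distribˡ-+ c (f x) (sum (map f xs))))

sum-map-zero : (xs : List A) → sum (map (λ _ → 0) xs) ≡ 0
sum-map-zero []       = refl
sum-map-zero (x ∷ xs) = sum-map-zero xs

sum-map-if : (b : Bool) (f : A → ℕ) (xs : List A) →
             sum (map (λ x → if b then f x else 0) xs) ≡ (if b then sum (map f xs) else 0)
sum-map-if true  f xs = refl
sum-map-if false f xs = sum-map-zero xs

sum-map-filterᵇ : (p : A → Bool) (f : A → ℕ) (xs : List A) →
                  sum (map f (filterᵇ p xs)) ≡ sum (map (λ x → if p x then f x else 0) xs)
sum-map-filterᵇ p f []       = refl
sum-map-filterᵇ p f (x ∷ xs) with p x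
... | true  = cong (f x +_) (sum-map-filterᵇ p f xs)
... | false = sum-map-filterᵇ p f xs

length-filterᵇ : (p : A → Bool) (xs : List A) →
                 length (filterᵇ p xs) ≡ sum (map (λ x → if p x then 1 else 0) xs)
length-filterᵇ p []       = refl
length-filterᵇ p (x ∷ xs) with p x
... | true  = cong suc (length-filterᵇ p xs)
... | false = length-filterᵇ p xs

if-*ʳ : (c : ℕ) (b : Bool) {x : ℕ} → (if b then c * x else 0) ≡ c * (if b then x else 0)
if-*ʳ c true  = refl
if-*ʳ c false = sym (*-zeroʳ c)

double : ℕ → ℕ
double zero    = zero
double (suc n) = suc (suc (double n))

double≡+ : ∀ n → double n ≡ n + n
double≡+ zero    = refl
double≡+ (suc n) = cong suc (trans (cong suc (double≡+ n)) (sym (+-suc n n)))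

even-double : ∀ k → even (double k) ≡ true
even-double zero    = refl
even-double (suc k) = even-double k

even-suc-double : ∀ k → even (suc (double k)) ≡ false
even-suc-double zero    = refl
even-suc-double (suc k) = even-suc-double k

sum-words-suc : (f : List MStep → ℕ) (n : ℕ) →
                sum (map f (words (suc n))) ≡
                sum (map (f ∘ (U ∷_)) (words n)) +
                (sum (map (f ∘ (D ∷_)) (words n)) + sum (map (f ∘ (H ∷_)) (words n)))
sum-words-suc f n = begin
  sum (map f (words (suc n)))
    ≡⟨ sum-map-concatMap f (λ w → (U ∷ w) ∷ (D ∷ w) ∷ (H ∷ w) ∷ []) (words n) ⟩
  sum (map (λ w → f (U ∷ w) + (f (D ∷ w) + (f (H ∷ w) + 0))) (words n))
    ≡⟨ cong sum (map-cong (λ w → cong (λ x → f (U ∷ w) + (f (D ∷ w) + x)) (+-identityʳ _)) (words n)) ⟩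
  sum (map (λ w → f (U ∷ w) + (f (D ∷ w) + f (H ∷ w))) (words n))
    ≡⟨ sum-map-+ (f ∘ (U ∷_)) _ (words n) ⟩
  sum (map (f ∘ (U ∷_)) (words n)) + sum (map (λ w → f (D ∷ w) + f (H ∷ w)) (words n))
    ≡⟨ cong (sum (map (f ∘ (U ∷_)) (words n)) +_) (sum-map-+ (f ∘ (D ∷_)) (f ∘ (H ∷_)) (words n)) ⟩
  sum (map (f ∘ (U ∷_)) (words n)) +
  (sum (map (f ∘ (D ∷_)) (words n)) + sum (map (f ∘ (H ∷_)) (words n))) ∎
  where open ≡-Reasoning

module Motzkin (α β : ℕ → ℕ) where

  pathWeight : ℕ → List MStep → ℕ
  pathWeight h w = if motzkinFrom h w then weightFrom α β h w else 0

  motzkinSum : ℕ → ℕ → ℕ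
  motzkinSum n h = sum (map (pathWeight h) (words n))

  Mot≡motzkinSum : ∀ n → Mot n α β ≡ motzkinSum n 0
  Mot≡motzkinSum n = sum-map-filterᵇ isMotzkin (weightFrom α β 0) (words n)

  pathWeight-U : ∀ h w → pathWeight h (U ∷ w) ≡ pathWeight (suc h) w
  pathWeight-U zero    w = refl
  pathWeight-U (suc h) w = refl

  pathWeight-D : ∀ h w → pathWeight (suc h) (D ∷ w) ≡ β h * pathWeight h w
  pathWeight-D h w = if-*ʳ (β h) (motzkinFrom h w)

  pathWeight-H : ∀ h w → pathWeight h (H ∷ w) ≡ α h * pathWeight h w
  pathWeight-H zero    w = if-*ʳ (α zero) (motzkinFrom zero w)
  pathWeight-H (suc h) w = if-*ʳ (α (suc h)) (motzkinFrom (suc h) w)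

  motzkinSum-suc-zero : ∀ n → motzkinSum (suc n) 0 ≡ motzkinSum n 1 + α 0 * motzkinSum n 0
  motzkinSum-suc-zero n =
    trans (sum-words-suc (pathWeight 0) n)
          (cong₂ _+_ (cong sum (map-cong (pathWeight-U 0) ws))
                     (cong₂ _+_ (sum-map-zero ws)
                                (trans (cong sum (map-cong (pathWeight-H 0) ws))
                                       (sum-map-* (α 0) (pathWeight 0) ws))))
    where ws = words n

  motzkinSum-suc-suc : ∀ n h → motzkinSum (suc n) (suc h) ≡
                       motzkinSum n (suc (suc h)) + (β h * motzkinSum n h + α (suc h) * motzkinSum n (suc h))
  motzkinSum-suc-suc n h =
    trans (sum-words-suc (pathWeight (suc h)) n)
          (cong₂ _+_ (cong sum (map-cong (pathWeight-U (suc h)) ws))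
                     (cong₂ _+_ (trans (cong sum (map-cong (pathWeight-D h) ws))
                                       (sum-map-* (β h) (pathWeight h) ws))
                                (trans (cong sum (map-cong (pathWeight-H (suc h)) ws))
                                       (sum-map-* (α (suc h)) (pathWeight (suc h)) ws))))
    where ws = words n

schIndicator : ℕ → List SStep → ℕ
schIndicator h s = if schEvenFrom h s then 1 else 0

schCount : ℕ → ℕ → ℕ
schCount m h = sum (map (schIndicator h) (swords m))

numSCHeven≡schCount : ∀ n → numSCHeven n ≡ schCount (n + n) 0
numSCHeven≡schCount n = length-filterᵇ (schEvenFrom 0) (swords (n + n))

schIndicator-U : ∀ h s → schIndicator h (SU ∷ s) ≡ schIndicator (suc h) s
schIndicator-U zero    s = refl
schIndicator-U (suc h) s = refl

schIndicator-HH : ∀ h s → schIndicator h (SHH ∷ s) ≡ (if even h then schIndicator h s else 0)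
schIndicator-HH zero    s = refl
schIndicator-HH (suc h) s with even (suc h)
... | true  = refl
... | false = refl

upDown : List (List SStep) → List (List SStep)
upDown = concatMap (λ w → (SU ∷ w) ∷ (SD ∷ w) ∷ [])

sum-upDown : (f : List SStep → ℕ) (ws : List (List SStep)) →
             sum (map f (upDown ws)) ≡ sum (map (f ∘ (SU ∷_)) ws) + sum (map (f ∘ (SD ∷_)) ws)
sum-upDown f ws =
  trans (sum-map-concatMap f (λ w → (SU ∷ w) ∷ (SD ∷ w) ∷ []) ws)
        (trans (cong sum (map-cong (λ w → cong (f (SU ∷ w) +_) (+-identityʳ (f (SD ∷ w)))) ws))
               (sum-map-+ (f ∘ (SU ∷_)) (f ∘ (SD ∷_)) ws))

count-upDown-zero : ∀ ws → sum (map (schIndicator 0) (upDown ws)) ≡ sum (map (schIndicator 1) ws)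
count-upDown-zero ws =
  trans (sum-upDown (schIndicator 0) ws) (trans (cong (sum (map (schIndicator 1) ws) +_) (sum-map-zero ws)) (+-identityʳ _))

count-upDown-suc : ∀ h ws → sum (map (schIndicator (suc h)) (upDown ws)) ≡
                   sum (map (schIndicator (suc (suc h))) ws) + sum (map (schIndicator h) ws)
count-upDown-suc h ws =
  trans (sum-upDown (schIndicator (suc h)) ws)
        (cong (_+ sum (map (schIndicator h) ws)) (cong sum (map-cong (schIndicator-U (suc h)) ws)))

count-HH : ∀ h ws → sum (map (schIndicator h) (map (SHH ∷_) ws)) ≡
           (if even h then sum (map (schIndicator h) ws) else 0)
count-HH h ws =
  trans (cong sum (sym (map-∘ ws)))
        (trans (cong sum (map-cong (schIndicator-HH h) ws)) (sum-map-if (even h) (schIndicator h) ws))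

schCount-suc-suc : ∀ m h → schCount (suc (suc m)) h ≡
                   sum (map (schIndicator h) (upDown (swords (suc m)))) + (if even h then schCount m h else 0)
schCount-suc-suc m h =
  trans (sum-map-++ (schIndicator h) (upDown (swords (suc m))) (map (SHH ∷_) (swords m)))
        (cong (sum (map (schIndicator h) (upDown (swords (suc m)))) +_) (count-HH h (swords m)))

open Motzkin αseq βseq

schCount-odd : ∀ n k → schCount (suc (double n)) (suc (double k)) ≡
               schCount (double n) (double (suc k)) + schCount (double n) (double k)
schCount-odd zero    k = count-upDown-suc (double k) (swords 0)
schCount-odd (suc n) k
  rewrite schCount-suc-suc (suc (double n)) (suc (double k)) | even-suc-double k =
  trans (+-identityʳ _) (count-upDown-suc (double k) (swords (suc (suc (double n)))))

schCount-double : ∀ n k → schCount (double n) (double k) ≡ motzkinSum n k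
schCount-double zero    zero    = refl
schCount-double zero    (suc k) = refl
schCount-double (suc n) zero    = begin
  schCount (double (suc n)) 0
    ≡⟨ schCount-suc-suc (double n) 0 ⟩
  sum (map (schIndicator 0) (upDown (swords (suc (double n))))) + schCount (double n) 0
    ≡⟨ cong (_+ schCount (double n) 0) (count-upDown-zero (swords (suc (double n)))) ⟩
  schCount (suc (double n)) 1 + schCount (double n) 0
    ≡⟨ cong (_+ schCount (double n) 0) (schCount-odd n 0) ⟩
  schCount (double n) 2 + schCount (double n) 0 + schCount (double n) 0
    ≡⟨ cong₂ (λ a b → a + b + b) (schCount-double n 1) (schCount-double n 0) ⟩
  motzkinSum n 1 + motzkinSum n 0 + motzkinSum n 0
    ≡⟨ regroup (motzkinSum n 1) (motzkinSum n 0) ⟩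
  motzkinSum n 1 + 2 * motzkinSum n 0
    ≡⟨ sym (motzkinSum-suc-zero n) ⟩
  motzkinSum (suc n) 0 ∎
  where
  open ≡-Reasoning
  regroup : ∀ a b → a + b + b ≡ a + 2 * b
  regroup = solve-∀
schCount-double (suc n) (suc k) = begin
  schCount (double (suc n)) (double (suc k))
    ≡⟨ schCount-suc-suc (double n) (double (suc k)) ⟩
  sum (map (schIndicator (double (suc k))) (upDown (swords (suc (double n))))) +
  (if even (double k) then schCount (double n) (double (suc k)) else 0)
    ≡⟨ cong₂ _+_ (count-upDown-suc (suc (double k)) (swords (suc (double n))))
                 (cong (λ b → if b then schCount (double n) (double (suc k)) else 0) (even-double k)) ⟩
  schCount (suc (double n)) (suc (double (suc k))) + schCount (suc (double n)) (suc (double k)) +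
  schCount (double n) (double (suc k))
    ≡⟨ cong₂ (λ a b → a + b + schCount (double n) (double (suc k))) (schCount-odd n (suc k)) (schCount-odd n k) ⟩
  (c₂ + c₁) + (c₁ + c₀) + c₁
    ≡⟨ cong₂ (λ a b → (a + b) + (b + c₀) + b) (schCount-double n (suc (suc k))) (schCount-double n (suc k)) ⟩
  (m₂ + m₁) + (m₁ + c₀) + m₁
    ≡⟨ cong (λ c → (m₂ + m₁) + (m₁ + c) + m₁) (schCount-double n k) ⟩
  (m₂ + m₁) + (m₁ + m₀) + m₁
    ≡⟨ regroup m₂ m₁ m₀ ⟩
  m₂ + (1 * m₀ + 3 * m₁)
    ≡⟨ sym (motzkinSum-suc-suc n k) ⟩
  motzkinSum (suc n) (suc k) ∎
  where
  open ≡-Reasoning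
  c₀ = schCount (double n) (double k)
  c₁ = schCount (double n) (double (suc k))
  c₂ = schCount (double n) (double (suc (suc k)))
  m₀ = motzkinSum n k
  m₁ = motzkinSum n (suc k)
  m₂ = motzkinSum n (suc (suc k))
  regroup : ∀ a b c → (a + b) + (b + c) + b ≡ a + (1 * c + 3 * b)
  regroup = solve-∀

-- The identity also holds for n = 0, where both sides are 1.
proposition3p1 : (n : ℕ) → n ≥ 1 → Mot n αseq βseq ≡ numSCHeven n
proposition3p1 n _ = begin
  Mot n αseq βseq           ≡⟨ Mot≡motzkinSum n ⟩
  motzkinSum n 0            ≡⟨ sym (schCount-double n 0) ⟩
  schCount (double n) 0     ≡⟨ cong (λ m → schCount m 0) (double≡+ n) ⟩
  schCount (n + n) 0        ≡⟨ sym (numSCHeven≡schCount n) ⟩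
  numSCHeven n              ∎
  where open ≡-Reasoning
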